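{- The categories $\square^{\mathrm{op}}$ and $\mathcal{G}_c$ (defined in the context) are isomorphic via an isomorphism whose object part is the identity on $\mathbb{N}$. In particular, for all $m,n\in\mathbb{N}$ there is a bijection $\mathrm{Hom}_{\square^{\mathrm{op}}}(m,n)\simeq \mathrm{Hom}_{\mathcal{G}_c}(m,n)$, and these bijections are compatible with identities and composition.
   Context: For $n\in\mathbb{N}$ let $[n]=\{0,\dots,n-1\}$. For sets $A,B,C$, a function $f:A\to B+C$ (disjoint union) is injective on the left part if $f(x)=f(y)=b$ with $b\in B$ implies $x=y$. The category $\square$ has objects $\mathbb{N}$; a morphism $m\to n$ is a function $f:[m]\to [n]+\{0,1\}$ that is injective on the left part; the composite of $f:m\to n$ and $g:n\to p$ is $(g+\mathrm{id}_{\{0,1\}})\circ f$ (where $g+\mathrm{id}$ sends $j\in[n]$ to $g(j)$ and fixes $0,1$). $\square^{\mathrm{op}}$ is its opposite category. A graph is a pair $(V,E)$ with $E\subseteq V\times V$. A graph morphism $(V,E)\to(V',E')$ is a function $f:V\to V'$ such that $(s,t)\in E$ implies $(f(s),f(t))\in E'$. The standard $n$-cube graph $C_n$ has vertex set $\{0,1\}^{n}$ (binary sequences $x_0x_1\cdots x_{n-1}$) and edges: a loop $(v,v)$ at every vertex, and for each pair of vertices $u,v$ that differ in exactly one coordinate $i$ with $u_i=0$, $v_i=1$, an edge $(u,v)$. Let $C_n^*$ be the preorder on vertices with $u\le v$ iff there is a directed chain of edges from $u$ to $v$ (this is the coordinatewise order); its binary meet $u\wedge v$ and join $u\vee v$ are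 the coordinatewise minimum and maximum. A graph morphism $g:C_m\to C_n$ preserves meets (resp. joins) if $g(u\wedge v)=g(u)\wedge g(v)$ (resp. $g(u\vee v)=g(u)\vee g(v)$) for all vertices $u,v$. The category $\mathcal{G}_c$ has objects $\mathbb{N}$; a morphism $m\to n$ is a graph morphism $C_m\to C_n$ preserving binary meets and binary joins; composition is composition of functions. -}

module Defs where

open import Data.Nat using (ℕ)
open import Data.Fin using (Fin)
open import Data.Bool using (Bool; true; false; _∧_; _∨_)
open import Data.Sum using (_⊎_; inj₁; inj₂)
open import Data.Product using (Σ; ∃; _×_; _,_; proj₁)
open import Data.Vec using (Vec; lookup; zipWith; tabulate)
open import Relation.Binary.PropositionalEquality using (_≡_; _≢_; refl)
open import Function using (_∘_)

-- The category □.  [n] = Fin n, {0,1} = Bool (false = 0, true = 1).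

LeftInjective : {m n : ℕ} → (Fin m → Fin n ⊎ Bool) → Set
LeftInjective {m} {n} f = ∀ (x y : Fin m) (b : Fin n) → f x ≡ inj₁ b → f y ≡ inj₁ b → x ≡ y

□Hom : ℕ → ℕ → Set
□Hom m n = Σ (Fin m → Fin n ⊎ Bool) LeftInjective

extend : {n p : ℕ} → (Fin n → Fin p ⊎ Bool) → Fin n ⊎ Bool → Fin p ⊎ Bool
extend g (inj₁ j) = g j
extend g (inj₂ b) = inj₂ b

□id : (n : ℕ) → □Hom n n
□id n = inj₁ , λ x y b p q → trans' p q
  where
  trans' : ∀ {x y b : Fin n} → inj₁ x ≡ inj₁ b → _≡_ {A = Fin n ⊎ Bool} (inj₁ y) (inj₁ b) → x ≡ y
  trans' refl refl = refl

□comp : {m n p : ℕ} → □Hom m n → □Hom n p → □Hom m p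
□comp {m} {n} {p} (f , fi) (g , gi) = (extend g ∘ f) , inj
  where
  inj : LeftInjective (extend g ∘ f)
  inj x y b ex ey with f x in eqx | f y in eqy
  ... | inj₁ j | inj₁ k with gi j k b ex ey
  ...   | refl = fi x y j eqx eqy
  inj x y b () ey | inj₂ _ | _
  inj x y b ex () | inj₁ _ | inj₂ _

_≈□_ : {m n : ℕ} → □Hom m n → □Hom m n → Set
_≈□_ {m} (f , _) (g , _) = ∀ (x : Fin m) → f x ≡ g x

Vertex : ℕ → Set
Vertex n = Vec Bool n

Edge : {n : ℕ} → Vertex n → Vertex n → Set
Edge {n} u v = (u ≡ v) ⊎
  (Σ (Fin n) λ i → (lookup u i ≡ false) × (lookup v i ≡ true)
                   × (∀ (j : Fin n) → j ≢ i → lookup u j ≡ lookup v j))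

IsGraphMorphism : {m n : ℕ} → (Vertex m → Vertex n) → Set
IsGraphMorphism g = ∀ s t → Edge s t → Edge (g s) (g t)

_⊓_ : {n : ℕ} → Vertex n → Vertex n → Vertex n
_⊓_ = zipWith _∧_

_⊔_ : {n : ℕ} → Vertex n → Vertex n → Vertex n
_⊔_ = zipWith _∨_

PreservesMeets : {m n : ℕ} → (Vertex m → Vertex n) → Set
PreservesMeets g = ∀ u v → g (u ⊓ v) ≡ g u ⊓ g v

PreservesJoins : {m n : ℕ} → (Vertex m → Vertex n) → Set
PreservesJoins g = ∀ u v → g (u ⊔ v) ≡ g u ⊔ g v

GcHom : ℕ → ℕ → Set
GcHom m n = Σ (Vertex m → Vertex n) λ g → IsGraphMorphism g × PreservesMeets g × PreservesJoins g

_≈G_ : {m n : ℕ} → GcHom m n → GcHom m n → Set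
_≈G_ {m} g h = ∀ (v : Vertex m) → proj₁ g v ≡ proj₁ h v

-- Hom_{□ᵒᵖ}(m,n) = □Hom n m.  The composite in □ᵒᵖ of a : m → n and
-- b : n → p is the □-composite □comp b a : □Hom p m.
-- Hom-sets are taken up to equality of underlying functions; a bijection
-- of hom-sets is a map that respects, reflects and is surjective up to it.

record IdOnObjectsIso : Set where
  field
    F        : {m n : ℕ} → □Hom n m → GcHom m n
    F-cong   : {m n : ℕ} (a b : □Hom n m) → a ≈□ b → F a ≈G F b
    F-inj    : {m n : ℕ} (a b : □Hom n m) → F a ≈G F b → a ≈□ b
    F-surj   : {m n : ℕ} (g : GcHom m n) → Σ (□Hom n m) λ a → F a ≈G g
    F-id     : (n : ℕ) (v : Vertex n) → proj₁ (F (□id n)) v ≡ v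
    F-comp   : {m n p : ℕ} (a : □Hom n m) (b : □Hom p n) (v : Vertex m) →
               proj₁ (F (□comp b a)) v ≡ proj₁ (F b) (proj₁ (F a) v)

-- A □-morphism a : n → m is a list of n bit-valued functions on {0,1}^m, each a
-- coordinate projection or a constant; applied coordinatewise it gives a map
-- C_m → C_n that commutes with the pointwise operations ∧ and ∨. Left-injectivity
-- says that no coordinate is projected twice, which is exactly what makes this map
-- send an edge (one flipped coordinate) to an edge. Conversely, each coordinate of
-- a map preserving ∧ and ∨ is a lattice map {0,1}^m → {0,1}, hence a constant or a
-- projection; and a graph morphism cannot repeat a projection, since the edge from
-- 0 to the unit vector e_b would then flip two coordinates of the image.
module Submission where

open import Defs
open import Data.Nat as ℕ using (ℕ)
open import Data.Fin using (Fin; zero; suc; _≟_)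
open import Data.Fin.Properties using (any?)
open import Data.Bool using (Bool; true; false; _∧_; _∨_) renaming (_≟_ to _≟ᵇ_)
open import Data.Bool.Properties
  using (∧-idem; ∨-idem; ∧-zeroˡ; ∧-zeroʳ; ∨-zeroʳ; ∧-identityʳ; ∨-identityˡ; ∨-identityʳ)
open import Data.Sum using (_⊎_; inj₁; inj₂)
open import Data.Sum.Properties using (≡-dec)
open import Data.Product using (Σ; ∃; _,_; proj₁; proj₂)
open import Data.Vec using (Vec; []; _∷_; lookup; zipWith; tabulate; replicate; _[_]≔_)
open import Data.Vec.Properties
  using (lookup∘tabulate; tabulate∘lookup; tabulate-cong; lookup-zipWith; lookup-replicate;
         lookup∘update; lookup∘update′; zipWith-zeroˡ; zipWith-identityˡ; zipWith-identityʳ)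
open import Data.Vec.Relation.Binary.Pointwise.Extensional using (ext; Pointwise-≡⇒≡)
open import Function using (_∘_)
open import Algebra.Definitions using (Idempotent; RightIdentity)
open import Relation.Nullary using (yes; no; contradiction)
open import Relation.Binary.PropositionalEquality
open ≡-Reasoning

private
  variable
    m n : ℕ
    i k : Fin m

lookup-ext : {A : Set} {xs ys : Vec A n} → (∀ i → lookup xs i ≡ lookup ys i) → xs ≡ ys
lookup-ext p = Pointwise-≡⇒≡ (ext p)

zipWith-update-absorbs : {A : Set} {f : A → A → A} {e b : A} → RightIdentity _≡_ e f →
                         f b b ≡ b → (v : Vec A n) (i : Fin n) → lookup v i ≡ b →
                         zipWith f v (replicate n e [ i ]≔ b) ≡ v
zipWith-update-absorbs {n = n} {f = f} {e} {b} idʳ fbb v i vi = lookup-ext at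
  where
  at : ∀ k → lookup (zipWith f v (replicate n e [ i ]≔ b)) k ≡ lookup v k
  at k with k ≟ i
  ... | yes refl = begin
    lookup (zipWith f v (replicate n e [ k ]≔ b)) k ≡⟨ lookup-zipWith f k v (replicate n e [ k ]≔ b) ⟩
    f (lookup v k) (lookup (replicate n e [ k ]≔ b) k) ≡⟨ cong₂ f vi (lookup∘update k (replicate n e) b) ⟩
    f b b                                               ≡⟨ trans fbb (sym vi) ⟩
    lookup v k                                          ∎
  ... | no k≢i = begin
    lookup (zipWith f v (replicate n e [ i ]≔ b)) k ≡⟨ lookup-zipWith f k v (replicate n e [ i ]≔ b) ⟩
    f (lookup v k) (lookup (replicate n e [ i ]≔ b) k)
      ≡⟨ cong (f (lookup v k)) (trans (lookup∘update′ k≢i (replicate n e) b) (lookup-replicate k e)) ⟩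
    f (lookup v k) e                                    ≡⟨ idʳ (lookup v k) ⟩
    lookup v k                                          ∎

𝟘 𝟙 : Vertex m
𝟘 = replicate _ false
𝟙 = replicate _ true

unit counit : Fin m → Vertex m
unit i = 𝟘 [ i ]≔ true
counit i = 𝟙 [ i ]≔ false

lookup-unit-≢ : k ≢ i → lookup (unit i) k ≡ false
lookup-unit-≢ {k = k} k≢i = trans (lookup∘update′ k≢i 𝟘 true) (lookup-replicate k false)

unit-edge : Edge 𝟘 (unit i)
unit-edge {i = i} = inj₂ (i , lookup-replicate i false , lookup∘update i 𝟘 true ,
                          λ k k≢i → trans (lookup-replicate k false) (sym (lookup-unit-≢ k≢i)))

counit-⊓-unit : (i : Fin m) → counit i ⊓ unit i ≡ 𝟘
counit-⊓-unit i = lookup-ext at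
  where
  at : ∀ k → lookup (counit i ⊓ unit i) k ≡ lookup 𝟘 k
  at k rewrite lookup-zipWith _∧_ k (counit i) (unit i) | lookup-replicate k false with k ≟ i
  ... | yes refl rewrite lookup∘update k 𝟙 false = refl
  ... | no k≢i rewrite lookup-unit-≢ k≢i = ∧-zeroʳ _

edge-flips-one-coordinate : {s t : Vertex m} {x y : Fin m} → Edge s t →
                            lookup s x ≡ false → lookup t x ≡ true →
                            lookup s y ≡ false → lookup t y ≡ true → x ≡ y
edge-flips-one-coordinate (inj₁ refl) sx tx _ _ = contradiction (trans (sym sx) tx) λ ()
edge-flips-one-coordinate {s = s} {t} (inj₂ (k , _ , _ , same)) sx tx sy ty =
  trans (flipped-is-k sx tx) (sym (flipped-is-k sy ty))
  where
  flipped-is-k : ∀ {z} → lookup s z ≡ false → lookup t z ≡ true → z ≡ k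
  flipped-is-k {z} sz tz with z ≟ k
  ... | yes z≡k = z≡k
  ... | no z≢k = contradiction (trans (sym sz) (trans (same z z≢k) tz)) λ ()

-- inj₁ i stands for the projection onto coordinate i, inj₂ b for the constant b.
eval : Fin m ⊎ Bool → Vertex m → Bool
eval (inj₁ i) v = lookup v i
eval (inj₂ b) _ = b

eval-zipWith : {f : Bool → Bool → Bool} → Idempotent _≡_ f →
               (c : Fin m ⊎ Bool) (u v : Vertex m) →
               eval c (zipWith f u v) ≡ f (eval c u) (eval c v)
eval-zipWith {f = f} _   (inj₁ i) u v = lookup-zipWith f i u v
eval-zipWith         idem (inj₂ b) u v = sym (idem b)

eval-off-edge : {s t : Vertex m} → (∀ j → j ≢ i → lookup s j ≡ lookup t j) →
                (c : Fin m ⊎ Bool) → c ≢ inj₁ i → eval c s ≡ eval c t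
eval-off-edge same (inj₁ k) k≢i = same k (λ k≡i → k≢i (cong inj₁ k≡i))
eval-off-edge same (inj₂ b) _   = refl

eval-injective : (c d : Fin m ⊎ Bool) → (∀ v → eval c v ≡ eval d v) → c ≡ d
eval-injective (inj₁ i) (inj₁ k) p with i ≟ k
... | yes i≡k = cong inj₁ i≡k
... | no i≢k = contradiction
  (trans (sym (lookup∘update i 𝟘 true)) (trans (p (unit i)) (lookup-unit-≢ (i≢k ∘ sym)))) λ ()
eval-injective (inj₁ i) (inj₂ b) p = contradiction
  (trans (sym (lookup-replicate i false)) (trans (p 𝟘) (trans (sym (p 𝟙)) (lookup-replicate i true)))) λ ()
eval-injective (inj₂ b) (inj₁ i) p = contradiction
  (trans (sym (lookup-replicate i false)) (trans (sym (p 𝟘)) (trans (p 𝟙) (lookup-replicate i true)))) λ ()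
eval-injective (inj₂ b) (inj₂ d) p = cong inj₂ (p 𝟘)

cubeMap : (Fin n → Fin m ⊎ Bool) → Vertex m → Vertex n
cubeMap a v = tabulate (λ j → eval (a j) v)

lookup-cubeMap : (a : Fin n → Fin m ⊎ Bool) (v : Vertex m) (j : Fin n) →
                 lookup (cubeMap a v) j ≡ eval (a j) v
lookup-cubeMap a v = lookup∘tabulate (λ j → eval (a j) v)

cubeMap-zipWith : {f : Bool → Bool → Bool} → Idempotent _≡_ f →
                  (a : Fin n → Fin m ⊎ Bool) (u v : Vertex m) →
                  cubeMap a (zipWith f u v) ≡ zipWith f (cubeMap a u) (cubeMap a v)
cubeMap-zipWith {f = f} idem a u v = lookup-ext λ j → begin
  lookup (cubeMap a (zipWith f u v)) j              ≡⟨ lookup-cubeMap a _ j ⟩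
  eval (a j) (zipWith f u v)                        ≡⟨ eval-zipWith idem (a j) u v ⟩
  f (eval (a j) u) (eval (a j) v)                   ≡⟨ sym (cong₂ f (lookup-cubeMap a u j) (lookup-cubeMap a v j)) ⟩
  f (lookup (cubeMap a u) j) (lookup (cubeMap a v) j) ≡⟨ sym (lookup-zipWith f j (cubeMap a u) (cubeMap a v)) ⟩
  lookup (zipWith f (cubeMap a u) (cubeMap a v)) j  ∎

cubeMap-isGraphMorphism : (a : □Hom n m) → IsGraphMorphism (cubeMap (proj₁ a))
cubeMap-isGraphMorphism a s t (inj₁ refl) = inj₁ refl
cubeMap-isGraphMorphism (a , a-inj) s t (inj₂ (i , si , ti , same))
  with any? (λ j → ≡-dec _≟_ _≟ᵇ_ (a j) (inj₁ i))
... | yes (j , aj≡i) = inj₂ (j , at-j s si , at-j t ti , λ k k≢j → unchanged k λ ak≡i → k≢j (a-inj k j i ak≡i aj≡i))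
  where
  at-j : ∀ {b} w → lookup w i ≡ b → lookup (cubeMap a w) j ≡ b
  at-j w wi = trans (lookup-cubeMap a w j) (trans (cong (λ c → eval c w) aj≡i) wi)
  unchanged : ∀ k → a k ≢ inj₁ i → lookup (cubeMap a s) k ≡ lookup (cubeMap a t) k
  unchanged k ak≢i = trans (lookup-cubeMap a s k)
    (trans (eval-off-edge same (a k) ak≢i) (sym (lookup-cubeMap a t k)))
... | no no-j = inj₁ (lookup-ext λ k → trans (lookup-cubeMap a s k)
  (trans (eval-off-edge same (a k) (λ ak≡i → no-j (k , ak≡i))) (sym (lookup-cubeMap a t k))))

cubeHom : □Hom n m → GcHom m n
cubeHom a = cubeMap (proj₁ a) , cubeMap-isGraphMorphism a ,
            cubeMap-zipWith ∧-idem (proj₁ a) , cubeMap-zipWith ∨-idem (proj₁ a)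

eval-extend : (a : Fin n → Fin m ⊎ Bool) (c : Fin n ⊎ Bool) (v : Vertex m) →
              eval (extend a c) v ≡ eval c (cubeMap a v)
eval-extend a (inj₁ j) v = sym (lookup-cubeMap a v j)
eval-extend a (inj₂ b) v = refl

-- Every vertex is the join of the unit vectors below it.
unit-witness : (h : Vertex m → Bool) → (∀ u v → h (u ⊔ v) ≡ h u ∨ h v) → h 𝟘 ≡ false →
               (v : Vertex m) → h v ≡ true → ∃ λ i → h (unit i) ≡ true
unit-witness-tail : (h : Vertex (ℕ.suc m) → Bool) → (∀ u v → h (u ⊔ v) ≡ h u ∨ h v) →
                    h 𝟘 ≡ false → (w : Vertex m) → h (false ∷ w) ≡ true → ∃ λ i → h (unit i) ≡ true

unit-witness h h-⊔ h𝟘 [] hv = contradiction (trans (sym h𝟘) hv) λ ()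
unit-witness h h-⊔ h𝟘 (false ∷ w) hv = unit-witness-tail h h-⊔ h𝟘 w hv
unit-witness h h-⊔ h𝟘 (true ∷ w) hv with h (unit zero) in h0
... | true = zero , h0
... | false = unit-witness-tail h h-⊔ h𝟘 w (begin
  h (false ∷ w)                ≡⟨⟩
  false ∨ h (false ∷ w)        ≡⟨ cong (_∨ h (false ∷ w)) (sym h0) ⟩
  h (unit zero) ∨ h (false ∷ w) ≡⟨ sym (h-⊔ (unit zero) (false ∷ w)) ⟩
  h (true ∷ (𝟘 ⊔ w))           ≡⟨ cong (λ u → h (true ∷ u)) (zipWith-identityˡ ∨-identityˡ w) ⟩
  h (true ∷ w)                 ≡⟨ hv ⟩
  true                         ∎)

unit-witness-tail h h-⊔ h𝟘 w hw
  with unit-witness (λ u → h (false ∷ u)) (λ u v → h-⊔ (false ∷ u) (false ∷ v)) h𝟘 w hw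
... | i , hi = suc i , hi

module _ (h : Vertex m → Bool)
         (h-⊓ : ∀ u v → h (u ⊓ v) ≡ h u ∧ h v)
         (h-⊔ : ∀ u v → h (u ⊔ v) ≡ h u ∨ h v) where

  projection-if-unit : h 𝟘 ≡ false → h (unit i) ≡ true → ∀ v → eval (inj₁ i) v ≡ h v
  projection-if-unit {i = i} h𝟘 hu v with lookup v i in vi
  ... | true = begin
    true               ≡⟨ sym (∨-zeroʳ (h v)) ⟩
    h v ∨ true         ≡⟨ cong (h v ∨_) (sym hu) ⟩
    h v ∨ h (unit i)   ≡⟨ sym (h-⊔ v (unit i)) ⟩
    h (v ⊔ unit i)     ≡⟨ cong h (zipWith-update-absorbs ∨-identityʳ refl v i vi) ⟩
    h v                ∎
  ... | false = begin
    false              ≡⟨ sym (∧-zeroʳ (h v)) ⟩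
    h v ∧ false        ≡⟨ cong (h v ∧_) (sym h-counit) ⟩
    h v ∧ h (counit i) ≡⟨ sym (h-⊓ v (counit i)) ⟩
    h (v ⊓ counit i)   ≡⟨ cong h (zipWith-update-absorbs ∧-identityʳ refl v i vi) ⟩
    h v                ∎
    where
    h-counit : h (counit i) ≡ false
    h-counit = begin
      h (counit i)              ≡⟨ sym (∧-identityʳ _) ⟩
      h (counit i) ∧ true       ≡⟨ cong (h (counit i) ∧_) (sym hu) ⟩
      h (counit i) ∧ h (unit i) ≡⟨ sym (h-⊓ (counit i) (unit i)) ⟩
      h (counit i ⊓ unit i)     ≡⟨ cong h (counit-⊓-unit i) ⟩
      h 𝟘                       ≡⟨ h𝟘 ⟩
      false                     ∎

  lattice-map-is-eval : ∃ λ c → ∀ v → eval c v ≡ h v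
  lattice-map-is-eval with h 𝟘 in h𝟘 | h 𝟙 in h𝟙
  ... | true | _ = inj₂ true , λ v → begin
    true        ≡⟨ sym h𝟘 ⟩
    h 𝟘         ≡⟨ cong h (sym (zipWith-zeroˡ ∧-zeroˡ v)) ⟩
    h (𝟘 ⊓ v)   ≡⟨ h-⊓ 𝟘 v ⟩
    h 𝟘 ∧ h v   ≡⟨ cong (_∧ h v) h𝟘 ⟩
    h v         ∎
  ... | false | false = inj₂ false , λ v → begin
    false       ≡⟨ sym (∧-zeroʳ (h v)) ⟩
    h v ∧ false ≡⟨ cong (h v ∧_) (sym h𝟙) ⟩
    h v ∧ h 𝟙   ≡⟨ sym (h-⊓ v 𝟙) ⟩
    h (v ⊓ 𝟙)   ≡⟨ cong h (zipWith-identityʳ ∧-identityʳ v) ⟩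
    h v         ∎
  ... | false | true with unit-witness h h-⊔ h𝟘 𝟙 h𝟙
  ...   | i , hu = inj₁ i , projection-if-unit h𝟘 hu

cubeHom-surjective : (g : GcHom m n) → Σ (□Hom n m) λ a → cubeHom a ≈G g
cubeHom-surjective {m = m} {n} (g , g-edge , g-⊓ , g-⊔) = (a , a-leftInjective) , cubeMap-a≈g
  where
  coordinate : ∀ j → ∃ λ c → ∀ v → eval c v ≡ lookup (g v) j
  coordinate j = lattice-map-is-eval (λ v → lookup (g v) j)
    (λ u v → trans (cong (λ w → lookup w j) (g-⊓ u v)) (lookup-zipWith _∧_ j (g u) (g v)))
    (λ u v → trans (cong (λ w → lookup w j) (g-⊔ u v)) (lookup-zipWith _∨_ j (g u) (g v)))

  a : Fin n → Fin m ⊎ Bool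
  a j = proj₁ (coordinate j)

  projects : ∀ {x b} → a x ≡ inj₁ b → ∀ v → lookup (g v) x ≡ lookup v b
  projects {x} ax v = trans (sym (proj₂ (coordinate x) v)) (cong (λ c → eval c v) ax)

  a-leftInjective : LeftInjective a
  a-leftInjective x y b ax ay = edge-flips-one-coordinate (g-edge 𝟘 (unit b) unit-edge)
    (trans (projects ax 𝟘) (lookup-replicate b false)) (trans (projects ax (unit b)) (lookup∘update b 𝟘 true))
    (trans (projects ay 𝟘) (lookup-replicate b false)) (trans (projects ay (unit b)) (lookup∘update b 𝟘 true))

  cubeMap-a≈g : ∀ v → cubeMap a v ≡ g v
  cubeMap-a≈g v = lookup-ext λ j → trans (lookup-cubeMap a v j) (proj₂ (coordinate j) v)

theorem2p11 : IdOnObjectsIso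
theorem2p11 = record
  { F      = cubeHom
  ; F-cong = λ a b a≈b v → tabulate-cong λ j → cong (λ c → eval c v) (a≈b j)
  ; F-inj  = λ a b Fa≈Fb x → eval-injective (proj₁ a x) (proj₁ b x) λ v → begin
      eval (proj₁ a x) v              ≡⟨ sym (lookup-cubeMap (proj₁ a) v x) ⟩
      lookup (cubeMap (proj₁ a) v) x  ≡⟨ cong (λ w → lookup w x) (Fa≈Fb v) ⟩
      lookup (cubeMap (proj₁ b) v) x  ≡⟨ lookup-cubeMap (proj₁ b) v x ⟩
      eval (proj₁ b x) v              ∎
  ; F-surj = cubeHom-surjective
  ; F-id   = λ n → tabulate∘lookup
  ; F-comp = λ a b v → tabulate-cong λ k → eval-extend (proj₁ a) (proj₁ b k) v
  }
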